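{- For all integers $r\geq 2$ and $d\geq 1$: (i) if $r'\geq r$, then $Z(r',d)\leq Z(r,d)$; (ii) $Z(r,d)\geq d+1$; (iii) if $r\geq d+1$, then $Z(r,d)\leq d+1$; (iv) $Z(r,r)\leq r+\lceil r/2\rceil+1$.
   Context: Given a coloring of the edges of a complete bipartite graph with parts $Y,Z$ using colors from $[r]$, a good partition of $Y$ is a partition $\{Y_1,\dots,Y_k\}$ of $Y$, $1\le k\le r$, parts allowed empty, such that for every $z\in Z$ there exist $i\in[k]$ and $y\in Y_i$ with $zy$ of color $i$. $Z(r,d)$ is the smallest positive integer $z$ such that, for the complete bipartite graph with parts $Y$ and $Z$ with $|Y|=d$ and $|Z|=z$, there exists a coloring of its edges with colors from $[r]$ for which there is no good partition of $Y$. -}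

module Defs where

open import Data.Nat using (ℕ; _≤_; _<_)
open import Data.Fin using (Fin; toℕ)
open import Data.Product using (Σ; ∃; _×_)
open import Relation.Binary.PropositionalEquality using (_≡_)
open import Relation.Nullary using (¬_)

-- An edge colouring of the complete bipartite graph with parts Y = Fin d and
-- Z = Fin z, using colours [r] = Fin r (colour i ∈ Fin r stands for i+1).
Coloring : ℕ → ℕ → ℕ → Set
Coloring r d z = Fin z → Fin d → Fin r

-- A partition {Y_1,…,Y_k} of Y into k labelled parts (parts may be empty) is a
-- map  p : Fin d → Fin k  sending y to the index of its part.
GoodPartition : (r d z : ℕ) → Coloring r d z → Set
GoodPartition r d z c =
  Σ ℕ λ k → (1 ≤ k) × (k ≤ r) ×
    Σ (Fin d → Fin k) λ p →
      (w : Fin z) → ∃ λ (y : Fin d) → toℕ (c w y) ≡ toℕ (p y)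

HasBadColoring : ℕ → ℕ → ℕ → Set
HasBadColoring r d z = Σ (Coloring r d z) λ c → ¬ GoodPartition r d z c

IsZ : ℕ → ℕ → ℕ → Set
IsZ r d z = (1 ≤ z) × HasBadColoring r d z ×
  ((z' : ℕ) → 1 ≤ z' → z' < z → ¬ HasBadColoring r d z')

-- Existence: with r ≥ 2 colours, the colouring whose r ^ d rows are all
-- functions Y → [r] is bad, since some row avoids the part index of every
-- vertex. Monotonicity in r: a bad colouring stays bad when read with more
-- colours, because parts whose index is not an old colour are useless.
-- Lower bound: with at most d vertices in Z, put the i-th vertex of Y into the
-- part named by the colour of its edge to the i-th vertex of Z. Upper bound for
-- r > d: if the i-th vertex of Z sees only colour i, a good partition needs
-- d + 1 vertices of Y in distinct parts.
-- Bound on Z(r,r): rows of constant colour j for every j force a good partition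
-- to put exactly one vertex of Y into each part 1,…,r. Then m further rows,
-- coloured 1 on a set K_t and 2 off it, defeat every such partition as soon as
-- no profile {t | y ∈ K_t} contains another one. An antichain of r subsets of a
-- set of size ⌈r/2⌉ + 1 exists for r ≠ 4; for r = 4 an explicit colouring is
-- checked by exhaustive search.
module Submission where

open import Defs
open import Data.Nat using (ℕ; zero; suc; _≤_; _<_; _+_; _∸_; _^_; ⌈_/2⌉; z≤n; s≤s; _<?_; _≤?_; _≟_; >-nonZero)
open import Data.Nat.Properties
open import Data.Nat.DivMod using (_mod_; _%_; m<n⇒m%n≡m)
open import Data.Nat.Induction using (<-rec)
open import Data.Fin as F using (Fin; #_; toℕ; fromℕ<; inject≤; splitAt; _↑ˡ_; _↑ʳ_; finToFun; funToFin)
open import Data.Fin.Properties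
  using (toℕ-injective; toℕ-fromℕ<; toℕ-inject≤; toℕ<n; any?; all?; pigeonhole; injective⇒≤; splitAt-↑ˡ; splitAt-↑ʳ; finToFun-funToFin)
  renaming (_≟_ to _≟ᶠ_)
open import Data.Product using (∃; _×_; _,_; proj₁; proj₂)
open import Data.Sum using (_⊎_; inj₁; inj₂)
open import Data.Unit using (tt)
open import Data.Vec using (Vec; []; _∷_; lookup)
open import Function using (_∘_; case_of_; _⇔_; mk⇔)
open import Relation.Nullary using (Dec; yes; no; ¬_; contradiction; ¬?; _×-dec_; _⊎-dec_)
open import Relation.Nullary.Decidable using (map; map′; toWitnessFalse)
open import Relation.Binary.PropositionalEquality using (_≡_; _≢_; _≗_; refl; sym; trans; cong; subst; module ≡-Reasoning)

Covers : ∀ {r d z k} → Coloring r d z → (Fin d → Fin k) → Set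
Covers {z = z} c p = (w : Fin z) → ∃ λ y → toℕ (c w y) ≡ toℕ (p y)

covers? : ∀ {r d z k} (c : Coloring r d z) (p : Fin d → Fin k) → Dec (Covers c p)
covers? c p = all? λ w → any? λ y → toℕ (c w y) ≟ toℕ (p y)

covers-resp : ∀ {r d z k} {c : Coloring r d z} {p q : Fin d → Fin k} → p ≗ q → Covers c p → Covers c q
covers-resp p≗q cov w = let (y , eq) = cov w in y , trans eq (cong toℕ (p≗q y))

covering⇔goodPartition : ∀ {r d z} (c : Coloring r d z) → 1 ≤ r → ∃ (Covers c) ⇔ GoodPartition r d z c
covering⇔goodPartition c 1≤r = mk⇔
  (λ (p , cov) → _ , 1≤r , ≤-refl , p , cov)
  (λ (k , _ , k≤r , p , cov) → (λ y → inject≤ (p y) k≤r) ,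
     λ w → let (y , eq) = cov w in y , trans eq (sym (toℕ-inject≤ (p y) k≤r)))

goodPartition-resp : ∀ {r d z} {c c' : Coloring r d z} → (∀ w y → c w y ≡ c' w y) →
                     GoodPartition r d z c → GoodPartition r d z c'
goodPartition-resp c≡c' (k , 1≤k , k≤r , p , cov) =
  k , 1≤k , k≤r , p , λ w → let (y , eq) = cov w in y , trans (cong toℕ (sym (c≡c' w y))) eq

∃-function? : ∀ {n k} {P : (Fin n → Fin k) → Set} → (∀ {f g} → f ≗ g → P f → P g) →
              (∀ f → Dec (P f)) → Dec (∃ P)
∃-function? resp P? = map′
  (λ (w , Pw) → finToFun w , Pw)
  (λ (f , Pf) → funToFin f , resp (λ y → sym (finToFun-funToFin f y)) Pf)
  (any? (P? ∘ finToFun))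

goodPartition? : ∀ {r d z} → 1 ≤ r → (c : Coloring r d z) → Dec (GoodPartition r d z c)
goodPartition? 1≤r c = map (covering⇔goodPartition c 1≤r) (∃-function? covers-resp (covers? c))

hasBadColoring? : ∀ {r d z} → 1 ≤ r → Dec (HasBadColoring r d z)
hasBadColoring? {r} {d} {z} 1≤r = map′
  (λ (e , bad) → finToFun ∘ e , bad)
  (λ (c , bad) → funToFin ∘ c , bad ∘ goodPartition-resp (λ w → finToFun-funToFin (c w)))
  (∃-function? resp (λ e → ¬? (goodPartition? 1≤r (finToFun ∘ e))))
  where
  Bad : (Fin z → Fin (r ^ d)) → Set
  Bad e = ¬ GoodPartition r d z (finToFun ∘ e)
  resp : ∀ {e e'} → e ≗ e' → Bad e → Bad e'
  resp e≗e' bad = bad ∘ goodPartition-resp (λ w y → cong (λ i → finToFun i y) (sym (e≗e' w)))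

Minimal : (ℕ → Set) → ℕ → Set
Minimal P m = P m × (∀ k → k < m → ¬ P k)

minimal-witness : {P : ℕ → Set} → (∀ n → Dec (P n)) → ∀ {n} → P n → ∃ (Minimal P)
minimal-witness {P} P? {n} = <-rec (λ n → P n → ∃ (Minimal P)) step n
  where
  step : ∀ n → (∀ {m} → m < n → P m → ∃ (Minimal P)) → P n → ∃ (Minimal P)
  step n below Pn with any? {n = n} (P? ∘ toℕ)
  ... | yes (k , Pk) = below (toℕ<n k) Pk
  ... | no ∄ = n , Pn , λ k k<n Pk → ∄ (fromℕ< k<n , subst P (sym (toℕ-fromℕ< k<n)) Pk)

IsZ-exists : ∀ {r d z} → 1 ≤ r → 1 ≤ z → HasBadColoring r d z → ∃ (IsZ r d)
IsZ-exists 1≤r 1≤z bad =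
  let (z , (1≤z , bad) , below) = minimal-witness (λ z → (1 ≤? z) ×-dec hasBadColoring? 1≤r) (1≤z , bad)
  in z , 1≤z , bad , λ z' 1≤z' z'<z bad' → below z' z'<z (1≤z' , bad')

IsZ-minimal : ∀ {r d z n} → IsZ r d z → 1 ≤ n → HasBadColoring r d n → z ≤ n
IsZ-minimal (_ , _ , below) 1≤n bad = ≮⇒≥ λ n<z → below _ 1≤n n<z bad

colourAvoiding : ∀ {r₀} → ℕ → Fin (2 + r₀)
colourAvoiding zero = # 1
colourAvoiding (suc _) = # 0

colourAvoiding-≢ : ∀ {r₀} n → toℕ (colourAvoiding {r₀} n) ≢ n
colourAvoiding-≢ zero ()
colourAvoiding-≢ (suc _) ()

exhaustive-bad : ∀ {r₀ d} → ¬ GoodPartition (2 + r₀) d ((2 + r₀) ^ d) finToFun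
exhaustive-bad (_ , _ , _ , p , cov) =
  let f = colourAvoiding ∘ toℕ ∘ p
      (y , eq) = cov (funToFin f)
  in colourAvoiding-≢ (toℕ (p y)) (trans (cong toℕ (sym (finToFun-funToFin f y))) eq)

hasBadColoring-exists : ∀ {r} d → 2 ≤ r → ∃ λ z → 1 ≤ z × HasBadColoring r d z
hasBadColoring-exists {suc (suc r₀)} d (s≤s (s≤s _)) = _ , m^n>0 (2 + r₀) d , finToFun , exhaustive-bad

hasBadColoring-mono : ∀ {r r' d z} → 1 ≤ r → r ≤ r' → HasBadColoring r d z → HasBadColoring r' d z
hasBadColoring-mono {suc r₀} {r'} {d} {z} _ r≤r' (c , bad) = c' , bad ∘ restrict
  where
  c' : Coloring r' d z
  c' w y = inject≤ (c w y) r≤r'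
  restrict : GoodPartition r' d z c' → GoodPartition (suc r₀) d z c
  restrict (_ , _ , _ , p , cov) = suc r₀ , s≤s z≤n , ≤-refl , (λ y → toℕ (p y) mod suc r₀) , covered
    where
    covered : Covers c (λ y → toℕ (p y) mod suc r₀)
    covered w = y , (begin
        toℕ (c w y)                    ≡⟨ cwy≡py ⟩
        toℕ (p y)                      ≡⟨ m<n⇒m%n≡m (subst (_< suc r₀) cwy≡py (toℕ<n (c w y))) ⟨
        toℕ (p y) % suc r₀             ≡⟨ toℕ-fromℕ< _ ⟨
        toℕ (toℕ (p y) mod suc r₀)     ∎)
      where
      open ≡-Reasoning
      y = proj₁ (cov w)
      cwy≡py : toℕ (c w y) ≡ toℕ (p y)
      cwy≡py = trans (sym (toℕ-inject≤ (c w y) r≤r')) (proj₂ (cov w))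

diagonal-good : ∀ {r d z} → 1 ≤ r → z ≤ d → (c : Coloring r d z) → GoodPartition r d z c
diagonal-good {suc r₀} {d} {z} _ z≤d c =
  suc r₀ , s≤s z≤n , ≤-refl , p , λ w → inject≤ w z≤d , cong toℕ (sym (p-diagonal w))
  where
  p : Fin d → Fin (suc r₀)
  p y with toℕ y <? z
  ... | yes y<z = c (fromℕ< y<z) y
  ... | no _ = # 0
  p-diagonal : ∀ w → p (inject≤ w z≤d) ≡ c w (inject≤ w z≤d)
  p-diagonal w with toℕ (inject≤ w z≤d) <? z
  ... | yes y<z = cong (λ v → c v (inject≤ w z≤d)) (toℕ-injective (trans (toℕ-fromℕ< y<z) (toℕ-inject≤ w z≤d)))
  ... | no y≮z = contradiction (subst (_< z) (sym (toℕ-inject≤ w z≤d)) (toℕ<n w)) y≮z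

hasBadColoring⇒> : ∀ {r d z} → 1 ≤ r → HasBadColoring r d z → d < z
hasBadColoring⇒> 1≤r (c , bad) = ≰⇒> λ z≤d → bad (diagonal-good 1≤r z≤d c)

constantRows-bad : ∀ {r d} (d+1≤r : d + 1 ≤ r) → ¬ GoodPartition r d (d + 1) (λ w _ → inject≤ w d+1≤r)
constantRows-bad d+1≤r (_ , _ , _ , p , cov) =
  let (i , j , i<j , yᵢ≡yⱼ) = pigeonhole (m<m+n _ (s≤s z≤n)) (proj₁ ∘ cov)
  in <-irrefl (begin
       toℕ i                 ≡⟨ toℕ-inject≤ i d+1≤r ⟨
       toℕ (inject≤ i d+1≤r)   ≡⟨ proj₂ (cov i) ⟩
       toℕ (p _)             ≡⟨ cong (toℕ ∘ p) yᵢ≡yⱼ ⟩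
       toℕ (p _)             ≡⟨ proj₂ (cov j) ⟨
       toℕ (inject≤ j d+1≤r)   ≡⟨ toℕ-inject≤ j d+1≤r ⟩
       toℕ j                 ∎) i<j
  where open ≡-Reasoning

preimage-unique : ∀ {n} (f : Fin n → ℕ) (s : Fin n → Fin n) → (∀ j → f (s j) ≡ toℕ j) →
                  ∀ {j y} → f y ≡ toℕ j → y ≡ s j
preimage-unique {n} f s fs≡ {j} {y} fy≡j with y ≟ᶠ s j
... | yes y≡sj = y≡sj
... | no y≢sj = contradiction (injective⇒≤ g-injective) 1+n≰n
  where
  g : Fin (suc n) → Fin n
  g F.zero = y
  g (F.suc i) = s i
  value : ∀ {i x} → x ≡ s i → f x ≡ toℕ i
  value refl = fs≡ _
  y≢s : ∀ i → y ≢ s i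
  y≢s i y≡si = y≢sj (trans y≡si (cong s (toℕ-injective (trans (sym (value y≡si)) fy≡j))))
  g-injective : ∀ {a b} → g a ≡ g b → a ≡ b
  g-injective {F.zero} {F.zero} _ = refl
  g-injective {F.zero} {F.suc i} y≡si = contradiction y≡si (y≢s i)
  g-injective {F.suc i} {F.zero} si≡y = contradiction (sym si≡y) (y≢s i)
  g-injective {F.suc i} {F.suc i'} si≡si' =
    cong F.suc (toℕ-injective (trans (sym (value refl)) (value si≡si')))

Separating : ∀ {m n} → (Fin m → Fin n → Set) → Set
Separating {n = n} K = ∀ {u v : Fin n} → u ≢ v → ∃ λ t → K t u × ¬ K t v

module _ {r₀ m} {K : Fin m → Fin (2 + r₀) → Set} (K? : ∀ t y → Dec (K t y)) where

  rowColour : Fin (2 + r₀) ⊎ Fin m → Fin (2 + r₀) → Fin (2 + r₀)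
  rowColour (inj₁ j) _ = j
  rowColour (inj₂ t) y with K? t y
  ... | yes _ = # 0
  ... | no _ = # 1

  rowColour-inj₂ : ∀ t y → (K t y × rowColour (inj₂ t) y ≡ # 0) ⊎ (¬ K t y × rowColour (inj₂ t) y ≡ # 1)
  rowColour-inj₂ t y with K? t y
  ... | yes Kty = inj₁ (Kty , refl)
  ... | no ¬Kty = inj₂ (¬Kty , refl)

  separatingColoring : Coloring (2 + r₀) (2 + r₀) (2 + r₀ + m)
  separatingColoring w = rowColour (splitAt (2 + r₀) w)

  separatingColoring-bad : Separating K → ¬ GoodPartition (2 + r₀) (2 + r₀) (2 + r₀ + m) separatingColoring
  separatingColoring-bad separating (_ , _ , _ , p , cov) = case rowColour-inj₂ t y of λ where
      (inj₁ (Kty , colour≡0)) → ¬Ktv (subst (K t) (only (trans (sym y-covers) (cong toℕ colour≡0))) Kty)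
      (inj₂ (¬Kty , colour≡1)) → ¬Kty (subst (K t) (sym (only (trans (sym y-covers) (cong toℕ colour≡1)))) Ktu)
    where
    r = 2 + r₀
    witness : Fin r → Fin r
    witness j = proj₁ (cov (j ↑ˡ m))
    p-witness : ∀ j → toℕ (p (witness j)) ≡ toℕ j
    p-witness j = sym (subst (λ s → toℕ (rowColour s (witness j)) ≡ toℕ (p (witness j)))
                             (splitAt-↑ˡ r j m) (proj₂ (cov (j ↑ˡ m))))
    only : ∀ {j y} → toℕ (p y) ≡ toℕ j → y ≡ witness j
    only = preimage-unique (toℕ ∘ p) witness p-witness
    u v : Fin r
    u = witness (# 1)
    v = witness (# 0)
    u≢v : u ≢ v
    u≢v u≡v = 1+n≢0 (trans (sym (p-witness (# 1))) (trans (cong (toℕ ∘ p) u≡v) (p-witness (# 0))))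
    t = proj₁ (separating u≢v)
    Ktu = proj₁ (proj₂ (separating u≢v))
    ¬Ktv = proj₂ (proj₂ (separating u≢v))
    y = proj₁ (cov (r ↑ʳ t))
    y-covers : toℕ (rowColour (inj₂ t) y) ≡ toℕ (p y)
    y-covers = subst (λ s → toℕ (rowColour s y) ≡ toℕ (p y)) (splitAt-↑ʳ r m t) (proj₂ (cov (r ↑ʳ t)))

singletons-separating : ∀ {n} → Separating {n} {n} _≡_
singletons-separating {u = u} u≢v = u , refl , u≢v

avoid-two : ∀ a b → ∃ λ t → t < 3 × t ≢ a × t ≢ b
avoid-two a b with 0 ≟ a | 0 ≟ b | 1 ≟ a | 1 ≟ b
... | no 0≢a | no 0≢b | _ | _ = 0 , s≤s z≤n , 0≢a , 0≢b
... | _ | _ | no 1≢a | no 1≢b = 1 , s≤s (s≤s z≤n) , 1≢a , 1≢b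
... | yes refl | _ | _ | yes refl = 2 , ≤-refl , (λ ()) , (λ ())
... | _ | yes refl | yes refl | _ = 2 , ≤-refl , (λ ()) , (λ ())
... | yes refl | _ | yes () | _
... | _ | yes refl | _ | yes ()

-- The profile of y < M is {y, M}, that of M ≤ y is [0, M) ∖ {y ∸ M}.
HalfSplit : ℕ → ℕ → ℕ → Set
HalfSplit M t y = (y < M × (t ≡ y ⊎ t ≡ M)) ⊎ (M ≤ y × t < M × t ≢ y ∸ M)

halfSplit? : ∀ M t y → Dec (HalfSplit M t y)
halfSplit? M t y = (y <? M ×-dec (t ≟ y ⊎-dec t ≟ M)) ⊎-dec (M ≤? y ×-dec t <? M ×-dec ¬? (t ≟ y ∸ M))

halfSplit-separates : ∀ {M u v} → 3 ≤ M → v < M + M → u ≢ v →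
                      ∃ λ t → t ≤ M × HalfSplit M t u × ¬ HalfSplit M t v
halfSplit-separates {M} {u} {v} 3≤M v<2M u≢v with u <? M | v <? M
... | yes u<M | yes v<M = u , <⇒≤ u<M , inj₁ (u<M , inj₁ refl) , λ where
  (inj₁ (_ , inj₁ u≡v)) → u≢v u≡v
  (inj₁ (_ , inj₂ u≡M)) → <-irrefl u≡M u<M
  (inj₂ (M≤v , _)) → <⇒≱ v<M M≤v
... | yes u<M | no v≮M = M , ≤-refl , inj₁ (u<M , inj₂ refl) , λ where
  (inj₁ (v<M , _)) → v≮M v<M
  (inj₂ (_ , M<M , _)) → <-irrefl refl M<M
... | no u≮M | yes v<M =
  let (t , t<3 , t≢u∸M , t≢v) = avoid-two (u ∸ M) v
      t<M = <-≤-trans t<3 3≤M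
  in t , <⇒≤ t<M , inj₂ (≮⇒≥ u≮M , t<M , t≢u∸M) , λ where
    (inj₁ (_ , inj₁ t≡v)) → t≢v t≡v
    (inj₁ (_ , inj₂ t≡M)) → <-irrefl t≡M t<M
    (inj₂ (M≤v , _)) → <⇒≱ v<M M≤v
... | no u≮M | no v≮M =
  let v∸M<M = m<n+o⇒m∸n<o v M {{>-nonZero (<-≤-trans (s≤s z≤n) 3≤M)}} v<2M
      v∸M≢u∸M = λ eq → u≢v (∸-cancelʳ-≡ (≮⇒≥ u≮M) (≮⇒≥ v≮M) (sym eq))
  in v ∸ M , <⇒≤ v∸M<M , inj₂ (≮⇒≥ u≮M , v∸M<M , v∸M≢u∸M) , λ where
    (inj₁ (v<M , _)) → v≮M v<M
    (inj₂ (_ , _ , v∸M≢v∸M)) → v∸M≢v∸M refl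

halfSplit-separating : ∀ {r M} → 3 ≤ M → r ≤ M + M →
                       Separating {suc M} {r} (λ t y → HalfSplit M (toℕ t) (toℕ y))
halfSplit-separating {M = M} 3≤M r≤2M {u} {v} u≢v =
  let (t , t≤M , t∈u , t∉v) = halfSplit-separates 3≤M (<-≤-trans (toℕ<n v) r≤2M) (u≢v ∘ toℕ-injective)
      toℕ-t = sym (toℕ-fromℕ< (s≤s t≤M))
  in fromℕ< (s≤s t≤M) , subst (λ s → HalfSplit M s (toℕ u)) toℕ-t t∈u
                      , subst (λ s → ¬ HalfSplit M s (toℕ v)) toℕ-t t∉v

coloring4 : Coloring 4 4 7
coloring4 w y = lookup (lookup rows w) y
  where
  rows : Vec (Vec (Fin 4) 4) 7
  rows = (# 0 ∷ # 0 ∷ # 0 ∷ # 0 ∷ []) ∷ (# 1 ∷ # 1 ∷ # 1 ∷ # 1 ∷ [])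
       ∷ (# 2 ∷ # 2 ∷ # 2 ∷ # 2 ∷ []) ∷ (# 3 ∷ # 3 ∷ # 3 ∷ # 3 ∷ [])
       ∷ (# 0 ∷ # 0 ∷ # 1 ∷ # 1 ∷ []) ∷ (# 1 ∷ # 1 ∷ # 2 ∷ # 2 ∷ []) ∷ (# 2 ∷ # 2 ∷ # 0 ∷ # 0 ∷ []) ∷ []

coloring4-bad : ¬ GoodPartition 4 4 7 coloring4
coloring4-bad = toWitnessFalse {a? = goodPartition? (s≤s z≤n) coloring4} tt

n≤⌈n/2⌉+⌈n/2⌉ : ∀ n → n ≤ ⌈ n /2⌉ + ⌈ n /2⌉
n≤⌈n/2⌉+⌈n/2⌉ n = subst (_≤ ⌈ n /2⌉ + ⌈ n /2⌉) (⌊n/2⌋+⌈n/2⌉≡n n) (+-monoˡ-≤ ⌈ n /2⌉ (⌊n/2⌋≤⌈n/2⌉ n))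

diagonal-bad : ∀ {r} → 2 ≤ r → HasBadColoring r r (r + ⌈ r /2⌉ + 1)
diagonal-bad {1} (s≤s ())
diagonal-bad {2} _ = separatingColoring _≟ᶠ_ , separatingColoring-bad _≟ᶠ_ singletons-separating
diagonal-bad {3} _ = separatingColoring _≟ᶠ_ , separatingColoring-bad _≟ᶠ_ singletons-separating
diagonal-bad {4} _ = coloring4 , coloring4-bad
diagonal-bad {r@(suc (suc (suc (suc (suc _)))))} _ =
  subst (HasBadColoring r r) (trans (cong (r +_) (+-comm 1 M)) (sym (+-assoc r M 1)))
    (separatingColoring K? , separatingColoring-bad K? (halfSplit-separating (s≤s (s≤s (s≤s z≤n))) (n≤⌈n/2⌉+⌈n/2⌉ r)))
  where
  M = ⌈ r /2⌉
  K? : ∀ (t : Fin (suc M)) (y : Fin r) → Dec (HalfSplit M (toℕ t) (toℕ y))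
  K? t y = halfSplit? M (toℕ t) (toℕ y)

mainTheorem13 : (r d : ℕ) → 2 ≤ r → 1 ≤ d →
    (∃ λ z → IsZ r d z)
    × ((r' z z' : ℕ) → r ≤ r' → IsZ r' d z' → IsZ r d z → z' ≤ z)
    × ((z : ℕ) → IsZ r d z → d + 1 ≤ z)
    × (d + 1 ≤ r → (z : ℕ) → IsZ r d z → z ≤ d + 1)
    × ((z : ℕ) → IsZ r r z → z ≤ r + ⌈ r /2⌉ + 1)
mainTheorem13 r d 2≤r _ =
    (let (_ , 1≤z , bad) = hasBadColoring-exists d 2≤r in IsZ-exists 1≤r 1≤z bad)
  , (λ _ _ _ r≤r' isZ' (1≤z , bad , _) → IsZ-minimal isZ' 1≤z (hasBadColoring-mono 1≤r r≤r' bad))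
  , (λ z (_ , bad , _) → subst (_≤ z) (+-comm 1 d) (hasBadColoring⇒> 1≤r bad))
  , (λ d+1≤r _ isZ → IsZ-minimal isZ (m≤n+m 1 d) (_ , constantRows-bad d+1≤r))
  , (λ _ isZ → IsZ-minimal isZ (m≤n+m 1 _) (diagonal-bad 2≤r))
  where
  1≤r : 1 ≤ r
  1≤r = ≤-trans (s≤s z≤n) 2≤r
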